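{- Let $D$ be a finite digraph with a list $L(v)$ of three colors assigned to each vertex $v$. Then there is a coloring $c$ with $c(v) \in L(v)$ for every vertex $v$ such that for each vertex $v$, the number of out-neighbors of $v$ colored $c(v)$ is at most $\frac{2}{3} d^+(v)$.
   Context: For a vertex $v$ of a digraph, $d^+(v)$ denotes the number of out-neighbors of $v$. -}

module Defs where

open import Data.Nat using (ℕ; _≡ᵇ_)
open import Data.Bool using (Bool; true; false; _∧_)
open import Data.Fin using (Fin)
open import Data.List using (List; filter; length)
open import Data.List using () renaming (allFin to allFinL)
open import Data.Product using (Σ; _×_)
open import Relation.Binary.PropositionalEquality using (_≡_; _≢_)
open import Function.Definitions using (Injective)
open import Relation.Nullary.Decidable using (Dec; yes; no)
open import Data.Bool.Properties using (T?)

record Digraph (n : ℕ) : Set where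
  field
    adj     : Fin n → Fin n → Bool
    loopless : ∀ v → adj v v ≡ false
open Digraph public

outdeg : ∀ {n} → Digraph n → Fin n → ℕ
outdeg D v = length (filter (λ u → T? (adj D v u)) (allFinL _))

sameColourOut : ∀ {n} → Digraph n → (Fin n → ℕ) → Fin n → ℕ → ℕ
sameColourOut D c v k =
  length (filter (λ u → T? (adj D v u ∧ (c u ≡ᵇ k))) (allFinL _))

ListAssignment3 : ℕ → Set
ListAssignment3 n = Σ (Fin n → Fin 3 → ℕ) (λ L → ∀ v → Injective _≡_ _≡_ (L v))

-- Choose positive weights w with ∑_{u→v} w u < (d⁺ v + 1) · w v at every vertex; they exist because
-- repeatedly raising the weight of a vertex where this fails keeps ∑ w ≤ ∑ (d⁺ v + 1).  Then take a
-- list colouring that no single recolouring improves for the potential ∑ w u over monochromatic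
-- arcs u → x.  Recolouring v changes the potential only through the arcs at v, so the weighted
-- conflicts of v in its own colour are at most those in each of its three list colours; these
-- three sum to at most w v · d⁺ v + ∑_{u→v} w u < w v · (2 d⁺ v + 1).  Dividing by w v bounds
-- three times the number of same-coloured out-neighbours of v by 2 d⁺ v.

module Submission where

open import Defs
open import Data.Bool using (Bool; true; false; _∧_; T)
open import Data.Empty using (⊥-elim)
open import Data.Fin using (Fin; zero; suc)
open import Data.Fin.Patterns using (0F; 1F; 2F)
open import Data.Fin.Properties using (_≟_; all?; any?; ¬∀⟶∃¬)
open import Data.List using (filter; length; tabulate)
open import Data.Nat using (ℕ; zero; suc; _+_; _*_; _∸_; _≤_; _<_; _≡ᵇ_; z≤n)
open import Data.Nat.Induction using (<-wellFounded)
open import Data.Nat.Properties hiding (_≟_)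
open import Algebra.Properties.Semiring.Sum +-*-semiring
  using (sum; sum-syntax; sum-cong-≗; ∑-distrib-+; ∑-comm; *-distribˡ-sum)
open import Data.Nat.Tactic.RingSolver using (solve-∀)
open import Data.Product using (Σ; _×_; ∃; _,_; proj₁; proj₂)
open import Data.Sum using (_⊎_; inj₁; inj₂)
open import Data.Unit using (tt)
open import Data.Vec.Functional using (updateAt)
open import Data.Vec.Functional.Properties using (updateAt-updates; updateAt-minimal)
open import Function using (_∘_; const; id)
open import Function.Definitions using (Injective)
open import Induction.WellFounded using (Acc; acc)
open import Relation.Binary.PropositionalEquality
open import Relation.Nullary using (¬_; does; yes; no)
open import Relation.Nullary.Decidable using (T?)

𝟙 : Bool → ℕ
𝟙 true  = 1
𝟙 false = 0

∑-mono-≤ : ∀ {n} {f g : Fin n → ℕ} → (∀ i → f i ≤ g i) → sum f ≤ sum g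
∑-mono-≤ {zero}  f≤g = z≤n
∑-mono-≤ {suc n} f≤g = +-mono-≤ (f≤g zero) (∑-mono-≤ (λ i → f≤g (suc i)))

∑-𝟙≟-* : ∀ {n} (v : Fin n) (f : Fin n → ℕ) → ∑[ u < n ] (𝟙 (does (u ≟ v)) * f u) ≡ f v
∑-𝟙≟-* zero    f =
  trans (cong₂ _+_ (+-identityʳ (f zero)) (∑-zero (λ u → f (suc u)))) (+-identityʳ (f zero))
  where
  ∑-zero : ∀ {m} (g : Fin m → ℕ) → ∑[ u < m ] (𝟙 (does (suc u ≟ zero)) * g u) ≡ 0
  ∑-zero {zero}  g = refl
  ∑-zero {suc m} g = ∑-zero (λ u → g (suc u))
∑-𝟙≟-* (suc v) f = ∑-𝟙≟-* v (λ u → f (suc u))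

∑-𝟙≟ : ∀ {n} (v : Fin n) → ∑[ u < n ] 𝟙 (does (u ≟ v)) ≡ 1
∑-𝟙≟ v = trans (sum-cong-≗ (λ u → sym (*-identityʳ (𝟙 (does (u ≟ v)))))) (∑-𝟙≟-* v (λ _ → 1))

length-filter-tabulate : ∀ {a} {A : Set a} {n} (p : A → Bool) (h : Fin n → A) →
  length (filter (λ x → T? (p x)) (tabulate h)) ≡ ∑[ i < n ] 𝟙 (p (h i))
length-filter-tabulate {n = zero}  p h = refl
length-filter-tabulate {n = suc n} p h with p (h zero)
... | true  = cong suc (length-filter-tabulate p (λ i → h (suc i)))
... | false = length-filter-tabulate p (λ i → h (suc i))

∑-distrib-+₃ : ∀ {n} (f g h : Fin n → ℕ) →
  ∑[ i < n ] (f i + g i + h i) ≡ ∑[ i < n ] f i + ∑[ i < n ] g i + ∑[ i < n ] h i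
∑-distrib-+₃ f g h =
  trans (∑-distrib-+ (λ i → f i + g i) h) (cong (_+ sum h) (∑-distrib-+ f g))

descend : ∀ {a p} {S : Set a} {Stop : S → Set p} (μ : S → ℕ) →
  (∀ s → Stop s ⊎ ∃ λ s′ → μ s′ < μ s) → S → ∃ Stop
descend {Stop = Stop} μ step s = go s (<-wellFounded (μ s))
  where
  go : ∀ s → Acc _<_ (μ s) → ∃ Stop
  go s (acc rs) with step s
  ... | inj₁ stop      = s , stop
  ... | inj₂ (s′ , lt) = go s′ (rs lt)

∑∑-cross : ∀ {n} (v : Fin n) (g h : Fin n → Fin n → ℕ) →
  (∀ u x → u ≢ v → x ≢ v → g u x ≡ h u x) → g v v ≡ h v v →
  ∑[ u < n ] ∑[ x < n ] g u x + (∑[ x < n ] h v x + ∑[ u < n ] h u v) ≡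
  ∑[ u < n ] ∑[ x < n ] h u x + (∑[ x < n ] g v x + ∑[ u < n ] g u v)
∑∑-cross {n} v g h off diag = begin
    ∑∑ g + (∑[ x < n ] h v x + ∑[ u < n ] h u v)  ≡⟨ crossed≡ g h ⟨
    ∑∑ (crossed g h)                              ≡⟨ sum-cong-≗ (λ u → sum-cong-≗ (crossed-comm u)) ⟩
    ∑∑ (crossed h g)                              ≡⟨ crossed≡ h g ⟩
    ∑∑ h + (∑[ x < n ] g v x + ∑[ u < n ] g u v)  ∎
  where
  open ≡-Reasoning
  [_≟v] : Fin n → ℕ
  [ u ≟v] = 𝟙 (does (u ≟ v))

  ∑∑ : (Fin n → Fin n → ℕ) → ℕ
  ∑∑ f = ∑[ u < n ] ∑[ x < n ] f u x

  crossed : (Fin n → Fin n → ℕ) → (Fin n → Fin n → ℕ) → Fin n → Fin n → ℕ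
  crossed f f′ u x = f u x + [ u ≟v] * f′ u x + [ x ≟v] * f′ u x

  crossed≡ : ∀ f f′ → ∑∑ (crossed f f′) ≡ ∑∑ f + (∑[ x < n ] f′ v x + ∑[ u < n ] f′ u v)
  crossed≡ f f′ = begin
      ∑∑ (crossed f f′)
    ≡⟨ sum-cong-≗ (λ u → ∑-distrib-+₃ (f u) (λ x → [ u ≟v] * f′ u x) (λ x → [ x ≟v] * f′ u x)) ⟩
      ∑[ u < n ] (∑[ x < n ] f u x + ∑[ x < n ] ([ u ≟v] * f′ u x) + ∑[ x < n ] ([ x ≟v] * f′ u x))
    ≡⟨ ∑-distrib-+₃ (λ u → ∑[ x < n ] f u x) (λ u → ∑[ x < n ] ([ u ≟v] * f′ u x))
                    (λ u → ∑[ x < n ] ([ x ≟v] * f′ u x)) ⟩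
      ∑∑ f + ∑[ u < n ] ∑[ x < n ] ([ u ≟v] * f′ u x) + ∑[ u < n ] ∑[ x < n ] ([ x ≟v] * f′ u x)
    ≡⟨ cong₂ (λ a b → ∑∑ f + a + b)
         (trans (sum-cong-≗ (λ u → sym (*-distribˡ-sum [ u ≟v] (f′ u))))
                (∑-𝟙≟-* v (λ u → ∑[ x < n ] f′ u x)))
         (sum-cong-≗ (λ u → ∑-𝟙≟-* v (f′ u))) ⟩
      ∑∑ f + ∑[ x < n ] f′ v x + ∑[ u < n ] f′ u v
    ≡⟨ +-assoc (∑∑ f) _ _ ⟩
      ∑∑ f + (∑[ x < n ] f′ v x + ∑[ u < n ] f′ u v)
    ∎

  crossed-comm : ∀ u x → crossed g h u x ≡ crossed h g u x
  crossed-comm u x with u ≟ v | x ≟ v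
  ... | yes refl | yes refl rewrite diag = refl
  ... | yes refl | no _     = swap (g u x) (h u x)
    where
    swap : ∀ a b → a + 1 * b + 0 * b ≡ b + 1 * a + 0 * a
    swap = solve-∀
  ... | no _     | yes refl = swap (g u x) (h u x)
    where
    swap : ∀ a b → a + 0 * b + 1 * b ≡ b + 0 * a + 1 * a
    swap = solve-∀
  ... | no u≢v   | no x≢v   = cong (λ a → a + 0 + 0) (off u x u≢v x≢v)

≡ᵇ-comm : ∀ m n → (m ≡ᵇ n) ≡ (n ≡ᵇ m)
≡ᵇ-comm zero    zero    = refl
≡ᵇ-comm zero    (suc n) = refl
≡ᵇ-comm (suc m) zero    = refl
≡ᵇ-comm (suc m) (suc n) = ≡ᵇ-comm m n

≡ᵇ-true : ∀ {m n} → (m ≡ᵇ n) ≡ true → m ≡ n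
≡ᵇ-true {m} {n} e = ≡ᵇ⇒≡ m n (subst T (sym e) tt)

module _ {a₀ a₁ a₂ : ℕ} (a₀≢a₁ : a₀ ≢ a₁) (a₀≢a₂ : a₀ ≢ a₂) (a₁≢a₂ : a₁ ≢ a₂) where

  𝟙-≡ᵇ-distinct : ∀ y → 𝟙 (y ≡ᵇ a₀) + 𝟙 (y ≡ᵇ a₁) + 𝟙 (y ≡ᵇ a₂) ≤ 1
  𝟙-≡ᵇ-distinct y with y ≡ᵇ a₀ in e₀ | y ≡ᵇ a₁ in e₁ | y ≡ᵇ a₂ in e₂
  ... | true  | true  | _     = ⊥-elim (a₀≢a₁ (trans (sym (≡ᵇ-true {y} e₀)) (≡ᵇ-true {y} e₁)))
  ... | true  | false | true  = ⊥-elim (a₀≢a₂ (trans (sym (≡ᵇ-true {y} e₀)) (≡ᵇ-true {y} e₂)))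
  ... | false | true  | true  = ⊥-elim (a₁≢a₂ (trans (sym (≡ᵇ-true {y} e₁)) (≡ᵇ-true {y} e₂)))
  ... | true  | false | false = ≤-refl
  ... | false | true  | false = ≤-refl
  ... | false | false | true  = ≤-refl
  ... | false | false | false = z≤n

  𝟙-≡ᵇ-distinctˡ : ∀ y → 𝟙 (a₀ ≡ᵇ y) + 𝟙 (a₁ ≡ᵇ y) + 𝟙 (a₂ ≡ᵇ y) ≤ 1
  𝟙-≡ᵇ-distinctˡ y rewrite ≡ᵇ-comm a₀ y | ≡ᵇ-comm a₁ y | ≡ᵇ-comm a₂ y = 𝟙-≡ᵇ-distinct y

*𝟙∧-≤ : ∀ m p b₀ b₁ b₂ → 𝟙 b₀ + 𝟙 b₁ + 𝟙 b₂ ≤ 1 →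
  m * 𝟙 (p ∧ b₀) + m * 𝟙 (p ∧ b₁) + m * 𝟙 (p ∧ b₂) ≤ m * 𝟙 p
*𝟙∧-≤ m p b₀ b₁ b₂ atMostOne = begin
    m * 𝟙 (p ∧ b₀) + m * 𝟙 (p ∧ b₁) + m * 𝟙 (p ∧ b₂)
  ≡⟨ distrib m (𝟙 (p ∧ b₀)) (𝟙 (p ∧ b₁)) (𝟙 (p ∧ b₂)) ⟨
    m * (𝟙 (p ∧ b₀) + 𝟙 (p ∧ b₁) + 𝟙 (p ∧ b₂))
  ≤⟨ *-monoʳ-≤ m (𝟙∧-≤ p) ⟩
    m * 𝟙 p
  ∎
  where
  open ≤-Reasoning
  distrib : ∀ m x y z → m * (x + y + z) ≡ m * x + m * y + m * z
  distrib = solve-∀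
  𝟙∧-≤ : ∀ p → 𝟙 (p ∧ b₀) + 𝟙 (p ∧ b₁) + 𝟙 (p ∧ b₂) ≤ 𝟙 p
  𝟙∧-≤ false = z≤n
  𝟙∧-≤ true  = atMostOne

weighted-two-thirds : ∀ w o d i → 3 * (w * o) ≤ w * d + i → i < suc d * w → 3 * o ≤ 2 * d
weighted-two-thirds w o d i wo≤ i< = <⇒≤pred (*-cancelˡ-< w (3 * o) (suc (2 * d)) (begin-strict
    w * (3 * o)       ≡⟨ lhs w o ⟩
    3 * (w * o)       ≤⟨ wo≤ ⟩
    w * d + i         <⟨ +-monoʳ-< (w * d) i< ⟩
    w * d + suc d * w ≡⟨ rhs w d ⟩
    w * suc (2 * d)   ∎))
  where
  open ≤-Reasoning
  lhs : ∀ w o → w * (3 * o) ≡ 3 * (w * o)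
  lhs = solve-∀
  rhs : ∀ w d → w * d + suc d * w ≡ w * suc (2 * d)
  rhs = solve-∀

module _ {n : ℕ} (D : Digraph n) where

  d⁺ : Fin n → ℕ
  d⁺ v = ∑[ u < n ] 𝟙 (adj D v u)

  inWeight : (Fin n → ℕ) → Fin n → ℕ
  inWeight w v = ∑[ u < n ] (w u * 𝟙 (adj D u v))

  Dominating : (Fin n → ℕ) → Set
  Dominating w = ∀ v → inWeight w v < suc (d⁺ v) * w v

  ∑-inWeight : ∀ w → ∑[ v < n ] inWeight w v ≡ ∑[ u < n ] (d⁺ u * w u)
  ∑-inWeight w = begin
    ∑[ v < n ] ∑[ u < n ] (w u * 𝟙 (adj D u v))  ≡⟨ ∑-comm (λ v u → w u * 𝟙 (adj D u v)) ⟩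
    ∑[ u < n ] ∑[ v < n ] (w u * 𝟙 (adj D u v))  ≡⟨ sum-cong-≗ (λ u → *-distribˡ-sum (w u) (λ v → 𝟙 (adj D u v))) ⟨
    ∑[ u < n ] (w u * d⁺ u)                      ≡⟨ sum-cong-≗ (λ u → *-comm (w u) (d⁺ u)) ⟩
    ∑[ u < n ] (d⁺ u * w u)                      ∎
    where open ≡-Reasoning

  inWeight-mono : ∀ {w w′} → (∀ u → w u ≤ w′ u) → ∀ v → inWeight w v ≤ inWeight w′ v
  inWeight-mono w≤w′ v = ∑-mono-≤ (λ u → *-monoˡ-≤ (𝟙 (adj D u v)) (w≤w′ u))

  -- Raising w at a vertex where Dominating fails preserves this, and it caps ∑ w (∑≤∑suc-d⁺).
  Subdominating : (Fin n → ℕ) → Set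
  Subdominating w = ∀ v → suc (d⁺ v) * w v ≤ suc (d⁺ v) + inWeight w v

  ∑≤∑suc-d⁺ : ∀ {w} → Subdominating w → ∑[ v < n ] w v ≤ ∑[ v < n ] suc (d⁺ v)
  ∑≤∑suc-d⁺ {w} sub = +-cancelʳ-≤ (∑[ u < n ] (d⁺ u * w u)) (sum w) (∑[ v < n ] suc (d⁺ v)) (begin
    ∑[ v < n ] w v + ∑[ u < n ] (d⁺ u * w u)        ≡⟨ ∑-distrib-+ w (λ u → d⁺ u * w u) ⟨
    ∑[ v < n ] (suc (d⁺ v) * w v)                   ≤⟨ ∑-mono-≤ sub ⟩
    ∑[ v < n ] (suc (d⁺ v) + inWeight w v)          ≡⟨ ∑-distrib-+ (λ v → suc (d⁺ v)) (inWeight w) ⟩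
    ∑[ v < n ] suc (d⁺ v) + ∑[ v < n ] inWeight w v ≡⟨ cong (sum (λ v → suc (d⁺ v)) +_) (∑-inWeight w) ⟩
    ∑[ v < n ] suc (d⁺ v) + ∑[ u < n ] (d⁺ u * w u) ∎)
    where open ≤-Reasoning

  bump : Fin n → (Fin n → ℕ) → Fin n → ℕ
  bump v w u = w u + 𝟙 (does (u ≟ v))

  ∑-bump : ∀ v w → ∑[ u < n ] bump v w u ≡ suc (∑[ u < n ] w u)
  ∑-bump v w = trans (∑-distrib-+ w (λ u → 𝟙 (does (u ≟ v))))
                     (trans (cong (sum w +_) (∑-𝟙≟ v)) (+-comm (sum w) 1))

  inWeight-bump : ∀ v w → inWeight (bump v w) v ≡ inWeight w v
  inWeight-bump v w = sum-cong-≗ bump-term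
    where
    bump-term : ∀ u → bump v w u * 𝟙 (adj D u v) ≡ w u * 𝟙 (adj D u v)
    bump-term u with u ≟ v
    ... | yes refl rewrite loopless D u = trans (*-zeroʳ (w u + 1)) (sym (*-zeroʳ (w u)))
    ... | no _     = cong (_* 𝟙 (adj D u v)) (+-identityʳ (w u))

  bump-subdominating : ∀ {v w} → Subdominating w → ¬ (inWeight w v < suc (d⁺ v) * w v) →
    Subdominating (bump v w)
  bump-subdominating {v} {w} sub ¬dom x with x ≟ v
  ... | yes refl = begin
    suc (d⁺ v) * (w v + 1)            ≡⟨ cong (suc (d⁺ v) *_) (+-comm (w v) 1) ⟩
    suc (d⁺ v) * suc (w v)            ≡⟨ *-suc (suc (d⁺ v)) (w v) ⟩
    suc (d⁺ v) + suc (d⁺ v) * w v     ≤⟨ +-monoʳ-≤ (suc (d⁺ v)) (≮⇒≥ ¬dom) ⟩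
    suc (d⁺ v) + inWeight w v         ≡⟨ cong (suc (d⁺ v) +_) (inWeight-bump v w) ⟨
    suc (d⁺ v) + inWeight (bump v w) v ∎
    where open ≤-Reasoning
  ... | no _ = begin
    suc (d⁺ x) * (w x + 0)            ≡⟨ cong (suc (d⁺ x) *_) (+-identityʳ (w x)) ⟩
    suc (d⁺ x) * w x                  ≤⟨ sub x ⟩
    suc (d⁺ x) + inWeight w x         ≤⟨ +-monoʳ-≤ (suc (d⁺ x)) (inWeight-mono (λ u → m≤m+n (w u) _) x) ⟩
    suc (d⁺ x) + inWeight (bump v w) x ∎
    where open ≤-Reasoning

  dominatingWeights : ∃ Dominating
  dominatingWeights =
    let ((w , _) , dom) = descend μ raise ((λ _ → 1) , subdominating-1) in w , dom
    where
    μ : Σ (Fin n → ℕ) Subdominating → ℕ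
    μ (w , _) = ∑[ v < n ] suc (d⁺ v) ∸ ∑[ v < n ] w v

    subdominating-1 : Subdominating (λ _ → 1)
    subdominating-1 v = ≤-trans (≤-reflexive (*-identityʳ (suc (d⁺ v)))) (m≤m+n (suc (d⁺ v)) _)

    raise : ∀ s → Dominating (proj₁ s) ⊎ ∃ λ s′ → μ s′ < μ s
    raise (w , sub) with all? (λ v → inWeight w v <? suc (d⁺ v) * w v)
    ... | yes dom = inj₁ dom
    ... | no ¬dom =
      let (v , ¬domᵥ) = ¬∀⟶∃¬ n _ (λ v → inWeight w v <? suc (d⁺ v) * w v) ¬dom
          sub′ = bump-subdominating sub ¬domᵥ
      in inj₂ ((bump v w , sub′) ,
               ∸-monoʳ-< (≤-reflexive (sym (∑-bump v w))) (∑≤∑suc-d⁺ sub′))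

module _ {n : ℕ} (D : Digraph n) (w : Fin n → ℕ) where

  potential : (Fin n → ℕ) → ℕ
  potential c = ∑[ u < n ] ∑[ x < n ] (w u * 𝟙 (adj D u x ∧ (c x ≡ᵇ c u)))

  conflicts : (Fin n → ℕ) → Fin n → ℕ → ℕ
  conflicts c v k = ∑[ x < n ] (w v * 𝟙 (adj D v x ∧ (c x ≡ᵇ k)))
                  + ∑[ u < n ] (w u * 𝟙 (adj D u v ∧ (k ≡ᵇ c u)))

  AgreeOff : Fin n → (Fin n → ℕ) → (Fin n → ℕ) → Set
  AgreeOff v c c′ = ∀ u → u ≢ v → c u ≡ c′ u

  conflicts-cong : ∀ {v c c′} → AgreeOff v c c′ → ∀ k → conflicts c v k ≡ conflicts c′ v k
  conflicts-cong {v} {c} {c′} agree k = cong₂ _+_ (sum-cong-≗ out) (sum-cong-≗ in′)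
    where
    out : ∀ x → w v * 𝟙 (adj D v x ∧ (c x ≡ᵇ k)) ≡ w v * 𝟙 (adj D v x ∧ (c′ x ≡ᵇ k))
    out x with x ≟ v
    ... | yes refl rewrite loopless D x = refl
    ... | no x≢v   rewrite agree x x≢v  = refl
    in′ : ∀ u → w u * 𝟙 (adj D u v ∧ (k ≡ᵇ c u)) ≡ w u * 𝟙 (adj D u v ∧ (k ≡ᵇ c′ u))
    in′ u with u ≟ v
    ... | yes refl rewrite loopless D u = refl
    ... | no u≢v   rewrite agree u u≢v  = refl

  potential-exchange : ∀ {v c c′} → AgreeOff v c c′ →
    potential c + conflicts c v (c′ v) ≡ potential c′ + conflicts c v (c v)
  potential-exchange {v} {c} {c′} agree = begin
    potential c + conflicts c v (c′ v)   ≡⟨ cong (potential c +_) (conflicts-cong agree (c′ v)) ⟩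
    potential c + conflicts c′ v (c′ v)  ≡⟨ ∑∑-cross v (arcs c) (arcs c′) same-off-v same-at-v ⟩
    potential c′ + conflicts c v (c v)   ∎
    where
    open ≡-Reasoning
    arcs : (Fin n → ℕ) → Fin n → Fin n → ℕ
    arcs c u x = w u * 𝟙 (adj D u x ∧ (c x ≡ᵇ c u))
    same-off-v : ∀ u x → u ≢ v → x ≢ v → arcs c u x ≡ arcs c′ u x
    same-off-v u x u≢v x≢v rewrite agree u u≢v | agree x x≢v = refl
    same-at-v : arcs c v v ≡ arcs c′ v v
    same-at-v rewrite loopless D v = refl

  potential-≤⇒conflicts-≤ : ∀ {v c c′} → AgreeOff v c c′ → potential c ≤ potential c′ →
    conflicts c v (c v) ≤ conflicts c v (c′ v)
  potential-≤⇒conflicts-≤ {v} {c} {c′} agree Φ≤Φ′ = +-cancelˡ-≤ (potential c′) _ _ (begin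
    potential c′ + conflicts c v (c v)   ≡⟨ potential-exchange agree ⟨
    potential c + conflicts c v (c′ v)   ≤⟨ +-monoˡ-≤ (conflicts c v (c′ v)) Φ≤Φ′ ⟩
    potential c′ + conflicts c v (c′ v)  ∎)
    where open ≤-Reasoning

  monochromaticOut≤conflicts : ∀ c v →
    w v * ∑[ x < n ] 𝟙 (adj D v x ∧ (c x ≡ᵇ c v)) ≤ conflicts c v (c v)
  monochromaticOut≤conflicts c v =
    ≤-trans (≤-reflexive (*-distribˡ-sum (w v) (λ x → 𝟙 (adj D v x ∧ (c x ≡ᵇ c v))))) (m≤m+n _ _)

  conflicts-distinct : ∀ {a₀ a₁ a₂} → a₀ ≢ a₁ → a₀ ≢ a₂ → a₁ ≢ a₂ → ∀ c v →
    conflicts c v a₀ + conflicts c v a₁ + conflicts c v a₂ ≤ w v * d⁺ D v + inWeight D w v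
  conflicts-distinct {a₀} {a₁} {a₂} a₀≢a₁ a₀≢a₂ a₁≢a₂ c v = begin
      conflicts c v a₀ + conflicts c v a₁ + conflicts c v a₂
    ≡⟨ interchange (out a₀) (in′ a₀) (out a₁) (in′ a₁) (out a₂) (in′ a₂) ⟩
      (out a₀ + out a₁ + out a₂) + (in′ a₀ + in′ a₁ + in′ a₂)
    ≡⟨ cong₂ _+_ (∑-distrib-+₃ (outᵢ a₀) (outᵢ a₁) (outᵢ a₂)) (∑-distrib-+₃ (inᵢ a₀) (inᵢ a₁) (inᵢ a₂)) ⟨
      ∑[ x < n ] (outᵢ a₀ x + outᵢ a₁ x + outᵢ a₂ x) + ∑[ u < n ] (inᵢ a₀ u + inᵢ a₁ u + inᵢ a₂ u)
    ≤⟨ +-mono-≤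
         (∑-mono-≤ (λ x → *𝟙∧-≤ (w v) (adj D v x) _ _ _ (𝟙-≡ᵇ-distinct a₀≢a₁ a₀≢a₂ a₁≢a₂ (c x))))
         (∑-mono-≤ (λ u → *𝟙∧-≤ (w u) (adj D u v) _ _ _ (𝟙-≡ᵇ-distinctˡ a₀≢a₁ a₀≢a₂ a₁≢a₂ (c u)))) ⟩
      ∑[ x < n ] (w v * 𝟙 (adj D v x)) + inWeight D w v
    ≡⟨ cong (_+ inWeight D w v) (*-distribˡ-sum (w v) (λ x → 𝟙 (adj D v x))) ⟨
      w v * d⁺ D v + inWeight D w v
    ∎
    where
    open ≤-Reasoning
    outᵢ : ℕ → Fin n → ℕ
    outᵢ k x = w v * 𝟙 (adj D v x ∧ (c x ≡ᵇ k))
    inᵢ : ℕ → Fin n → ℕ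
    inᵢ k u = w u * 𝟙 (adj D u v ∧ (k ≡ᵇ c u))
    out in′ : ℕ → ℕ
    out k = sum (outᵢ k)
    in′ k = sum (inᵢ k)
    interchange : ∀ a b c d e f → a + b + (c + d) + (e + f) ≡ a + c + e + (b + d + f)
    interchange = solve-∀

  module _ (L : Fin n → Fin 3 → ℕ) where

    colouring : (Fin n → Fin 3) → Fin n → ℕ
    colouring f v = L v (f v)

    LocallyOptimal : (Fin n → Fin 3) → Set
    LocallyOptimal f = ∀ v i → potential (colouring f) ≤ potential (colouring (updateAt f v (const i)))

    locallyOptimalChoice : ∃ LocallyOptimal
    locallyOptimalChoice = descend (potential ∘ colouring) improve (const zero)
      where
      improve : ∀ f → LocallyOptimal f ⊎ ∃ λ f′ → potential (colouring f′) < potential (colouring f)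
      improve f with any? (λ v → any? (λ i →
                       potential (colouring (updateAt f v (const i))) <? potential (colouring f)))
      ... | yes (v , i , better) = inj₂ (updateAt f v (const i) , better)
      ... | no ¬better           = inj₁ λ v i → ≮⇒≥ λ better → ¬better (v , i , better)

    locallyOptimal⇒conflicts-≤ : ∀ {f} → LocallyOptimal f → ∀ v i →
      conflicts (colouring f) v (colouring f v) ≤ conflicts (colouring f) v (L v i)
    locallyOptimal⇒conflicts-≤ {f} opt v i =
      subst (λ k → conflicts (colouring f) v (colouring f v) ≤ conflicts (colouring f) v k)
            (cong (L v) (updateAt-updates v f))
            (potential-≤⇒conflicts-≤ agree (opt v i))
      where
      agree : AgreeOff v (colouring f) (colouring (updateAt f v (const i)))
      agree u u≢v = cong (L u) (sym (updateAt-minimal u v f u≢v))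

    locallyOptimal⇒bound : ∀ {f} → LocallyOptimal f → (∀ v → Injective _≡_ _≡_ (L v)) → ∀ v →
      3 * (w v * ∑[ x < n ] 𝟙 (adj D v x ∧ (colouring f x ≡ᵇ colouring f v)))
        ≤ w v * d⁺ D v + inWeight D w v
    locallyOptimal⇒bound {f} opt L-inj v = begin
        3 * (w v * ∑[ x < n ] 𝟙 (adj D v x ∧ (c x ≡ᵇ c v)))
      ≤⟨ *-monoʳ-≤ 3 (monochromaticOut≤conflicts c v) ⟩
        3 * conflicts c v (c v)
      ≡⟨ triple (conflicts c v (c v)) ⟩
        conflicts c v (c v) + conflicts c v (c v) + conflicts c v (c v)
      ≤⟨ +-mono-≤ (+-mono-≤ (optimal 0F) (optimal 1F)) (optimal 2F) ⟩
        conflicts c v (L v 0F) + conflicts c v (L v 1F) + conflicts c v (L v 2F)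
      ≤⟨ conflicts-distinct (distinct {0F} {1F} λ ()) (distinct {0F} {2F} λ ())
                            (distinct {1F} {2F} λ ()) c v ⟩
        w v * d⁺ D v + inWeight D w v
      ∎
      where
      open ≤-Reasoning
      c = colouring f
      optimal = locallyOptimal⇒conflicts-≤ opt v
      distinct : ∀ {i j} → i ≢ j → L v i ≢ L v j
      distinct i≢j = i≢j ∘ L-inj v
      triple : ∀ x → 3 * x ≡ x + x + x
      triple = solve-∀

corollary2 : (n : ℕ) (D : Digraph n) (L : ListAssignment3 n) →
    Σ (Fin n → ℕ) λ c →
      (∀ v → ∃ λ i → c v ≡ proj₁ L v i) ×
      (∀ v → 3 * sameColourOut D c v (c v) ≤ 2 * outdeg D v)
corollary2 n D (L , L-inj) = c , (λ v → f v , refl) , two-thirds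
  where
  w = proj₁ (dominatingWeights D)
  dominating = proj₂ (dominatingWeights D)
  f = proj₁ (locallyOptimalChoice D w L)
  optimal = proj₂ (locallyOptimalChoice D w L)
  c = colouring D w L f
  two-thirds : ∀ v → 3 * sameColourOut D c v (c v) ≤ 2 * outdeg D v
  two-thirds v =
    subst₂ (λ o d → 3 * o ≤ 2 * d)
      (sym (length-filter-tabulate (λ u → adj D v u ∧ (c u ≡ᵇ c v)) id))
      (sym (length-filter-tabulate (adj D v) id))
      (weighted-two-thirds (w v) _ (d⁺ D v) (inWeight D w v)
        (locallyOptimal⇒bound D w L optimal L-inj v) (dominating v))
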